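{- In any Q-structure, for any $A,B\subseteq\mathcal P$: $(A\cdot B)^\perp\subseteq\big(((A^\perp)^\perp)\cdot B\big)^\perp$.
   Context: A Q-structure is a tuple $\langle\mathcal P,\mathcal Z,\cdot,1\rangle$ with $\mathcal P$ a set, $\mathcal Z\subseteq\mathcal P$, $\cdot$ a binary operation on $\mathcal P$ (not assumed associative or commutative), and $1\in\mathcal P$. These satisfy, for all $x,y,z$: $x\cdot y\in\mathcal Z$ iff $y\cdot x\in\mathcal Z$; $(x\cdot y)\cdot z\in\mathcal Z$ iff $x\cdot(z\cdot y)\in\mathcal Z$; and $1\cdot x=x\cdot1=x$. For $A\subseteq\mathcal P$, $A^\perp=\{b: b\cdot a\in\mathcal Z\ \forall a\in A\}$. For $A,B\subseteq\mathcal P$, $A\cdot B=\{a\cdot b:a\in A,b\in B\}$. -}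

module Defs where

open import Level using (Level; _⊔_; suc)
open import Relation.Binary.PropositionalEquality using (_≡_)
open import Data.Product using (Σ-syntax; _×_; ∃-syntax)
open import Relation.Unary using (Pred; _⊆_; _∈_)

record QStructure (c ℓ : Level) : Set (Level.suc (c ⊔ ℓ)) where
  infixl 7 _·_
  field
    Carrier : Set c
    Z       : Pred Carrier ℓ
    _·_     : Carrier → Carrier → Carrier
    one     : Carrier
    comm-Z  : ∀ x y → (x · y ∈ Z → y · x ∈ Z) × (y · x ∈ Z → x · y ∈ Z)
    assoc-Z : ∀ x y z → ((x · y) · z ∈ Z → x · (z · y) ∈ Z)
                      × (x · (z · y) ∈ Z → (x · y) · z ∈ Z)
    identityˡ : ∀ x → one · x ≡ x
    identityʳ : ∀ x → x · one ≡ x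

  _⊥ : ∀ {r} → Pred Carrier r → Pred Carrier (c ⊔ ℓ ⊔ r)
  (A ⊥) b = ∀ a → a ∈ A → b · a ∈ Z

  _⊙_ : ∀ {r s} → Pred Carrier r → Pred Carrier s → Pred Carrier (c ⊔ r ⊔ s)
  (A ⊙ B) x = ∃[ a ] ∃[ b ] (a ∈ A × b ∈ B × x ≡ a · b)

{-# OPTIONS --safe #-}
-- For x ∈ (A · B)^⊥ and b ∈ B the element x · b lies in A^⊥, so every c ∈ A^⊥⊥
-- annihilates it; the symmetry and associativity rules for Z then turn
-- c · (x · b) ∈ Z back into x · (c · b) ∈ Z.
module Submission where

open import Defs
open import Level using (Level)
open import Relation.Unary using (Pred; _⊆_; _∈_)
open import Data.Product using (_,_; proj₁; proj₂)
open import Relation.Binary.PropositionalEquality using (refl; subst; sym)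

module _ {c ℓ : Level} (Q : QStructure c ℓ) where
  open QStructure Q

  ·-Z-shuffleʳ : ∀ x y z → x · (z · y) ∈ Z → (x · y) · z ∈ Z
  ·-Z-shuffleʳ x y z = proj₂ (assoc-Z x y z)

  ·-Z-shuffleˡ : ∀ x y z → (x · y) · z ∈ Z → x · (z · y) ∈ Z
  ·-Z-shuffleˡ x y z = proj₁ (assoc-Z x y z)

  ·-Z-sym : ∀ x y → x · y ∈ Z → y · x ∈ Z
  ·-Z-sym x y = proj₁ (comm-Z x y)

  ·ʳ-∈-⊥ : ∀ {r s} {A : Pred Carrier r} {B : Pred Carrier s} {x b} →
           x ∈ (A ⊙ B) ⊥ → b ∈ B → x · b ∈ A ⊥
  ·ʳ-∈-⊥ {x = x} {b} x⊥AB b∈B a a∈A =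
    ·-Z-shuffleʳ x b a (x⊥AB (a · b) (a , b , a∈A , b∈B , refl))

  ∈⊥⊥-·ʳ-∈Z : ∀ {r} {A : Pred Carrier r} {x b c} →
                 x · b ∈ A ⊥ → c ∈ (A ⊥) ⊥ → x · (c · b) ∈ Z
  ∈⊥⊥-·ʳ-∈Z {x = x} {b} {c} xb∈A⊥ c∈A⊥⊥ =
    ·-Z-shuffleˡ x b c (·-Z-sym c (x · b) (c∈A⊥⊥ (x · b) xb∈A⊥))

lemma7 : ∀ {c ℓ : Level} (Q : QStructure c ℓ) → let open QStructure Q in
    ∀ {r s : Level} (A : Pred Carrier r) (B : Pred Carrier s) →
    ((A ⊙ B) ⊥) ⊆ ((((A ⊥) ⊥) ⊙ B) ⊥)
lemma7 Q A B {x} x⊥AB y (c , b , c∈A⊥⊥ , b∈B , y≡c·b) =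
  subst (λ t → x · t ∈ Z) (sym y≡c·b)
    (∈⊥⊥-·ʳ-∈Z Q (·ʳ-∈-⊥ Q {A = A} x⊥AB b∈B) c∈A⊥⊥)
  where open QStructure Q
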